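{- For every integer $i\ge1$, $\lim_{k\to\infty}\overline{\alpha}(\{1,2i+1,2k\})=\frac12$.
   Context: For a finite set $S$ of positive integers, the distance graph $G(S)$ has vertex set $\mathbb{Z}$, with $i,j$ adjacent iff $|i-j|\in S$. For $A\subseteq\mathbb{Z}$, $\delta(A)=\limsup_{N\to\infty}\frac{|A\cap[-N,N]|}{2N+1}$. The independence ratio $\overline{\alpha}(S)$ is the supremum of $\delta(A)$ over all independent sets $A$ of $G(S)$. -}

module Defs where

open import Data.Bool using (Bool; true)
open import Data.Nat as ℕ using (ℕ; zero; suc)
open import Data.Integer as ℤ using (ℤ; +_; ∣_∣)
open import Data.Rational as ℚ using (ℚ; _/_; 0ℚ)
open import Data.List using (List; []; _∷_)
open import Data.List.Membership.Propositional using (_∈_)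
open import Data.Product using (Σ; ∃; _×_)
open import Data.Empty using (⊥)
open import Relation.Binary.PropositionalEquality using (_≡_)

Subsetℤ : Set
Subsetℤ = ℤ → Bool

Independent : List ℕ → Subsetℤ → Set
Independent S A = ∀ x y → A x ≡ true → A y ≡ true → ∣ x ℤ.- y ∣ ∈ S → ⊥

countFrom : Subsetℤ → ℤ → ℕ → ℕ
countFrom A lo zero = 0
countFrom A lo (suc n) with A (lo ℤ.+ + n)
... | true  = suc (countFrom A lo n)
... | _     = countFrom A lo n

count : Subsetℤ → ℕ → ℕ
count A N = countFrom A (ℤ.- (+ N)) (suc (2 ℕ.* N))

ratio : Subsetℤ → ℕ → ℚ
ratio A N = (+ count A N) / suc (2 ℕ.* N)

-- δ(A) > r   (limsup of ratios strictly exceeds r)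
DensityGt : Subsetℤ → ℚ → Set
DensityGt A r = Σ ℚ λ r' → r ℚ.< r' × (∀ N₀ → Σ ℕ λ N → N₀ ℕ.≤ N × r' ℚ.≤ ratio A N)

-- δ(A) ≤ r   (limsup of ratios is at most r)
DensityLe : Subsetℤ → ℚ → Set
DensityLe A r = ∀ ε → 0ℚ ℚ.< ε → Σ ℕ λ N₀ → ∀ N → N₀ ℕ.≤ N → ratio A N ℚ.≤ r ℚ.+ ε

-- ᾱ(S) > r  (sup over independent sets of δ exceeds r)
AlphaGt : List ℕ → ℚ → Set
AlphaGt S r = ∃ λ A → Independent S A × DensityGt A r

AlphaLt : List ℕ → ℚ → Set
AlphaLt S r = Σ ℚ λ r' → r' ℚ.< r × (∀ A → Independent S A → DensityLe A r')

S3 : ℕ → ℕ → List ℕ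
S3 i k = 1 ∷ suc (2 ℕ.* i) ∷ 2 ℕ.* k ∷ []

-- Upper bound: since 1 ∈ S, an independent set contains no two consecutive integers, so it meets any
-- window of n integers in at most (n + 1)/2 points.
-- Lower bound: put H = 2k, D = 2i + 1 and L = H − D, and write x = qH + s with 0 ≤ s < H. The set of
-- those x with s < L and s + q even is independent: a distance d ≤ D (here 1 or D) keeps q and, being
-- odd, flips the parity of s; the distance H keeps s and flips the parity of q. The set is 2H-periodic
-- with exactly L points per period (in the blocks q = 0 and q = 1 the residues s < L are split by
-- parity), so its density is L/(2H), which tends to 1/2.
module Submission where

open import Defs

open import Data.Bool using (Bool; true; false; not)
open import Data.Bool.Properties using (T-≡)
open import Data.Empty using (⊥; ⊥-elim)
open import Data.Integer as ℤ using (ℤ; +_; -[1+_]; +[1+_]; 0ℤ; 1ℤ; ∣_∣)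
open import Data.Integer.DivMod using (n%ℕd<d; a≡a%ℕn+[a/ℕn]*n)
import Data.Integer.Properties as ℤP
open import Algebra.Properties.AbelianGroup ℤP.+-0-abelianGroup as ℤ+ using ()
import Data.Integer.Tactic.RingSolver as ZS
open import Data.List.Membership.Propositional using (_∈_)
open import Data.List.Relation.Unary.Any using (here; there)
open import Data.Nat as ℕ using (ℕ; zero; suc; _+_; _*_; _∸_; _≤_; _<_; _<?_; z≤n; s≤s)
open import Data.Nat.Properties
open import Data.Nat.Tactic.RingSolver using (solve-∀)
open import Data.Product using (Σ; _×_; _,_; proj₁; proj₂)
open import Data.Rational as ℚ using (ℚ; mkℚ; 0ℚ; ½; _/_)
import Data.Rational.Properties as ℚP
open import Data.Rational.Unnormalised as ℚᵘ using (mkℚᵘ)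
import Data.Rational.Unnormalised.Properties as ℚᵘP
open import Data.Sum using (_⊎_; inj₁; inj₂)
open import Function using (_∘_)
open import Function.Bundles using (Equivalence)
open import Relation.Binary.Definitions using (tri<; tri≈; tri>)
open import Relation.Binary.PropositionalEquality
open import Relation.Nullary using (Dec; yes; no; _×-dec_)
open import Relation.Nullary.Decidable using (toWitness; ⌊_⌋)

indicator : Bool → ℕ
indicator true  = 1
indicator false = 0

indicator-disjoint : ∀ {a b} → (a ≡ true → b ≡ true → ⊥) → indicator a + indicator b ≤ 1
indicator-disjoint {true}  {true}  a∧b = ⊥-elim (a∧b refl refl)
indicator-disjoint {true}  {false} _   = ≤-refl
indicator-disjoint {false} {_}     _   = indicator≤1
  where
  indicator≤1 : ∀ {b} → indicator b ≤ 1
  indicator≤1 {true}  = ≤-refl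
  indicator≤1 {false} = z≤n

indicator-+-not : ∀ a → indicator a + indicator (not a) ≡ 1
indicator-+-not true  = refl
indicator-+-not false = refl

module _ (A : Subsetℤ) where

  countFrom-suc : ∀ lo n → countFrom A lo (suc n) ≡ indicator (A (lo ℤ.+ + n)) + countFrom A lo n
  countFrom-suc lo n with A (lo ℤ.+ + n)
  ... | true  = refl
  ... | false = refl

  countFrom-+ : ∀ lo m n → countFrom A lo (m + n) ≡ countFrom A lo m + countFrom A (lo ℤ.+ + m) n
  countFrom-+ lo m zero = trans (cong (countFrom A lo) (+-identityʳ m)) (sym (+-identityʳ _))
  countFrom-+ lo m (suc n) = begin
    countFrom A lo (m + suc n)
      ≡⟨ cong (countFrom A lo) (+-suc m n) ⟩
    countFrom A lo (suc (m + n))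
      ≡⟨ countFrom-suc lo (m + n) ⟩
    indicator (A (lo ℤ.+ + (m + n))) + countFrom A lo (m + n)
      ≡⟨ cong₂ _+_ (cong (indicator ∘ A) shift) (countFrom-+ lo m n) ⟩
    indicator (A (lo ℤ.+ + m ℤ.+ + n)) + (countFrom A lo m + countFrom A (lo ℤ.+ + m) n)
      ≡⟨ +-assoc-comm (indicator (A (lo ℤ.+ + m ℤ.+ + n))) (countFrom A lo m) _ ⟩
    countFrom A lo m + (indicator (A (lo ℤ.+ + m ℤ.+ + n)) + countFrom A (lo ℤ.+ + m) n)
      ≡⟨ cong (_+_ (countFrom A lo m)) (sym (countFrom-suc (lo ℤ.+ + m) n)) ⟩
    countFrom A lo m + countFrom A (lo ℤ.+ + m) (suc n) ∎
    where
    open ≡-Reasoning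
    shift : lo ℤ.+ + (m + n) ≡ lo ℤ.+ + m ℤ.+ + n
    shift = trans (cong (ℤ._+_ lo) (ℤP.pos-+ m n)) (sym (ℤP.+-assoc lo (+ m) (+ n)))
    +-assoc-comm : ∀ a b c → a + (b + c) ≡ b + (a + c)
    +-assoc-comm = solve-∀

  countFrom-mono : ∀ lo {m n} → m ≤ n → countFrom A lo m ≤ countFrom A lo n
  countFrom-mono lo {m} {n} m≤n = begin
    countFrom A lo m                                     ≤⟨ m≤m+n _ _ ⟩
    countFrom A lo m + countFrom A (lo ℤ.+ + m) (n ∸ m)  ≡⟨ countFrom-+ lo m (n ∸ m) ⟨
    countFrom A lo (m + (n ∸ m))                         ≡⟨ cong (countFrom A lo) (m+[n∸m]≡n m≤n) ⟩
    countFrom A lo n                                     ∎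
    where open ≤-Reasoning

  countFrom-no-consecutive : (∀ x → A x ≡ true → A (x ℤ.+ 1ℤ) ≡ true → ⊥) →
                             ∀ lo n → 2 * countFrom A lo n ≤ suc n
  countFrom-no-consecutive _ lo zero = z≤n
  countFrom-no-consecutive apart lo (suc zero) =
    subst (λ c → 2 * c ≤ 2) (sym (countFrom-suc lo 0))
      (*-monoʳ-≤ 2 (indicator-disjoint {A (lo ℤ.+ + 0)} {false} λ _ ()))
  countFrom-no-consecutive apart lo (suc (suc n)) = begin
    2 * countFrom A lo (suc (suc n))
      ≡⟨ cong (2 *_) (trans (countFrom-suc lo (suc n)) (cong (_+_ i₁) (countFrom-suc lo n))) ⟩
    2 * (i₁ + (i₀ + countFrom A lo n))
      ≡⟨ regroup i₁ i₀ (countFrom A lo n) ⟩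
    2 * (i₀ + i₁) + 2 * countFrom A lo n
      ≤⟨ +-mono-≤ (*-monoʳ-≤ 2 (indicator-disjoint λ a₀ a₁ → apart (lo ℤ.+ + n) a₀ (subst (λ x → A x ≡ true) next a₁)))
                  (countFrom-no-consecutive apart lo n) ⟩
    2 + suc n ∎
    where
    open ≤-Reasoning
    i₀ = indicator (A (lo ℤ.+ + n))
    i₁ = indicator (A (lo ℤ.+ + suc n))
    next : lo ℤ.+ + suc n ≡ lo ℤ.+ + n ℤ.+ 1ℤ
    next = trans (cong (ℤ._+_ lo) (trans (cong +_ (+-comm 1 n)) (ℤP.pos-+ n 1))) (sym (ℤP.+-assoc lo (+ n) 1ℤ))
    regroup : ∀ a b c → 2 * (a + (b + c)) ≡ 2 * (b + a) + 2 * c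
    regroup = solve-∀

countFrom-cong : ∀ {A B lo lo′} n → (∀ j → j < n → A (lo ℤ.+ + j) ≡ B (lo′ ℤ.+ + j)) →
                 countFrom A lo n ≡ countFrom B lo′ n
countFrom-cong zero _ = refl
countFrom-cong {A} {B} {lo} {lo′} (suc n) A≡B =
  trans (countFrom-suc A lo n)
    (trans (cong₂ _+_ (cong indicator (A≡B n ≤-refl)) (countFrom-cong n λ j j<n → A≡B j (m<n⇒m<1+n j<n)))
           (sym (countFrom-suc B lo′ n)))

countFrom-complement : ∀ {A B lo lo′} n → (∀ j → j < n → B (lo′ ℤ.+ + j) ≡ not (A (lo ℤ.+ + j))) →
                       countFrom A lo n + countFrom B lo′ n ≡ n
countFrom-complement zero _ = refl
countFrom-complement {A} {B} {lo} {lo′} (suc n) B≡¬A = begin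
  countFrom A lo (suc n) + countFrom B lo′ (suc n)
    ≡⟨ cong₂ _+_ (countFrom-suc A lo n) (countFrom-suc B lo′ n) ⟩
  (indicator a + countFrom A lo n) + (indicator (B (lo′ ℤ.+ + n)) + countFrom B lo′ n)
    ≡⟨ cong (λ b → (indicator a + countFrom A lo n) + (indicator b + countFrom B lo′ n)) (B≡¬A n ≤-refl) ⟩
  (indicator a + countFrom A lo n) + (indicator (not a) + countFrom B lo′ n)
    ≡⟨ interchange (indicator a) _ _ _ ⟩
  (indicator a + indicator (not a)) + (countFrom A lo n + countFrom B lo′ n)
    ≡⟨ cong₂ _+_ (indicator-+-not a) (countFrom-complement n λ j j<n → B≡¬A j (m<n⇒m<1+n j<n)) ⟩
  suc n ∎
  where
  open ≡-Reasoning
  a = A (lo ℤ.+ + n)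
  interchange : ∀ w x y z → (w + x) + (y + z) ≡ (w + y) + (x + z)
  interchange = solve-∀

module Periodic (A : Subsetℤ) (M : ℕ) (periodic : ∀ x → A (x ℤ.+ + M) ≡ A x) where

  periodic-* : ∀ t x → A (x ℤ.+ + (t * M)) ≡ A x
  periodic-* zero    x = cong A (ℤP.+-identityʳ x)
  periodic-* (suc t) x = begin
    A (x ℤ.+ + (M + t * M))     ≡⟨ cong A (trans (cong (ℤ._+_ x) (ℤP.pos-+ M (t * M))) (shuffle x (+ M) _)) ⟩
    A (x ℤ.+ + (t * M) ℤ.+ + M) ≡⟨ periodic _ ⟩
    A (x ℤ.+ + (t * M))         ≡⟨ periodic-* t x ⟩
    A x                         ∎
    where
    open ≡-Reasoning
    shuffle : ∀ a b c → a ℤ.+ (b ℤ.+ c) ≡ a ℤ.+ c ℤ.+ b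
    shuffle = ZS.solve-∀

  countFrom-shift : ∀ lo n → countFrom A (lo ℤ.+ + M) n ≡ countFrom A lo n
  countFrom-shift lo n = countFrom-cong n λ j _ → trans (cong A (shuffle lo (+ M) (+ j))) (periodic _)
    where
    shuffle : ∀ a b c → a ℤ.+ b ℤ.+ c ≡ a ℤ.+ c ℤ.+ b
    shuffle = ZS.solve-∀

  countFrom-periods : ∀ lo t → countFrom A lo (t * M) ≡ t * countFrom A lo M
  countFrom-periods lo zero    = refl
  countFrom-periods lo (suc t) =
    trans (countFrom-+ A lo M (t * M))
          (cong (_+_ (countFrom A lo M)) (trans (countFrom-shift lo (t * M)) (countFrom-periods lo t)))

  count-periods : ∀ t → (2 * t) * countFrom A 0ℤ M ≤ count A (t * M)
  count-periods t = begin
    (2 * t) * countFrom A 0ℤ M    ≡⟨ cong ((2 * t) *_) (countFrom-cong M λ j _ → sym (recentre j)) ⟩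
    (2 * t) * countFrom A lo M    ≡⟨ countFrom-periods lo (2 * t) ⟨
    countFrom A lo (2 * t * M)    ≡⟨ cong (countFrom A lo) (*-assoc 2 t M) ⟩
    countFrom A lo (2 * (t * M))  ≤⟨ countFrom-mono A lo (n≤1+n _) ⟩
    count A (t * M)               ∎
    where
    open ≤-Reasoning
    lo = ℤ.- + (t * M)
    recentre : ∀ j → A (lo ℤ.+ + j) ≡ A (0ℤ ℤ.+ + j)
    recentre j = trans (sym (periodic-* t (lo ℤ.+ + j))) (cong A (cancel (+ (t * M)) (+ j)))
      where
      cancel : ∀ a b → ℤ.- a ℤ.+ b ℤ.+ a ≡ 0ℤ ℤ.+ b
      cancel = ZS.solve-∀

module _ {d : ℕ} .{{_ : ℕ.NonZero d}} where

  private
    <-next-quotient : ∀ {r r′} {q q′ : ℤ} → r < d → q ℤ.< q′ → + r ℤ.+ q ℤ.* + d ℤ.< + r′ ℤ.+ q′ ℤ.* + d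
    <-next-quotient {r} {r′} {q} {q′} r<d q<q′ = begin-strict
      + r ℤ.+ q ℤ.* + d       <⟨ ℤP.+-monoˡ-< (q ℤ.* + d) (ℤ.+<+ r<d) ⟩
      + d ℤ.+ q ℤ.* + d       ≡⟨ suc-* q (+ d) ⟩
      ℤ.suc q ℤ.* + d         ≤⟨ ℤP.*-monoʳ-≤-nonNeg (+ d) (ℤP.i<j⇒suc[i]≤j q<q′) ⟩
      q′ ℤ.* + d              ≤⟨ ℤP.i≤j+i (q′ ℤ.* + d) (+ r′) ⟩
      + r′ ℤ.+ q′ ℤ.* + d     ∎
      where
      open ℤP.≤-Reasoning
      suc-* : ∀ a b → b ℤ.+ a ℤ.* b ≡ (1ℤ ℤ.+ a) ℤ.* b
      suc-* = ZS.solve-∀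

  divMod-unique : ∀ {r r′} (q q′ : ℤ) → r < d → r′ < d →
                  + r ℤ.+ q ℤ.* + d ≡ + r′ ℤ.+ q′ ℤ.* + d → r ≡ r′ × q ≡ q′
  divMod-unique q q′ r<d r′<d eq with ℤP.<-cmp q q′
  ... | tri< q<q′ _ _ = ⊥-elim (ℤP.<-irrefl eq (<-next-quotient r<d q<q′))
  ... | tri> _ _ q′<q = ⊥-elim (ℤP.<-irrefl (sym eq) (<-next-quotient r′<d q′<q))
  ... | tri≈ _ refl _ = ℤP.+-injective (ℤ+.∙-cancelʳ (q ℤ.* + d) _ _ eq) , refl

  %ℕ-/ℕ-unique : ∀ {x r} q → r < d → x ≡ + r ℤ.+ q ℤ.* + d → x ℤ.%ℕ d ≡ r × x ℤ./ℕ d ≡ q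
  %ℕ-/ℕ-unique {x} q r<d x≡ =
    divMod-unique (x ℤ./ℕ d) q (n%ℕd<d x d) r<d (trans (sym (a≡a%ℕn+[a/ℕn]*n x d)) x≡)

  %ℕ-unique : ∀ {x r} q → r < d → x ≡ + r ℤ.+ q ℤ.* + d → x ℤ.%ℕ d ≡ r
  %ℕ-unique q r<d = proj₁ ∘ %ℕ-/ℕ-unique q r<d

  [x+m*d]%ℕd≡x%ℕd : ∀ x m → (x ℤ.+ m ℤ.* + d) ℤ.%ℕ d ≡ x ℤ.%ℕ d
  [x+m*d]%ℕd≡x%ℕd x m = %ℕ-unique (x ℤ./ℕ d ℤ.+ m) (n%ℕd<d x d)
    (trans (cong (λ y → y ℤ.+ m ℤ.* + d) (a≡a%ℕn+[a/ℕn]*n x d)) (regroup (+ (x ℤ.%ℕ d)) (x ℤ./ℕ d) m (+ d)))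
    where
    regroup : ∀ r q m d → r ℤ.+ q ℤ.* d ℤ.+ m ℤ.* d ≡ r ℤ.+ (q ℤ.+ m) ℤ.* d
    regroup = ZS.solve-∀

even-+-odd : ∀ {z} → z ℤ.%ℕ 2 ≡ 0 → ∀ j → (z ℤ.+ + suc (2 * j)) ℤ.%ℕ 2 ≢ 0
even-+-odd {z} even j = subst (_≢ 0) (sym odd) λ ()
  where
  z≡ : z ≡ 0ℤ ℤ.+ z ℤ./ℕ 2 ℤ.* + 2
  z≡ = subst (λ r → z ≡ + r ℤ.+ z ℤ./ℕ 2 ℤ.* + 2) even (a≡a%ℕn+[a/ℕn]*n z 2)
  odd-offset : + suc (2 * j) ≡ 1ℤ ℤ.+ + j ℤ.* + 2
  odd-offset = trans (ℤP.pos-+ 1 (2 * j)) (cong (ℤ._+_ 1ℤ) (trans (cong +_ (*-comm 2 j)) (ℤP.pos-* j 2)))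
  regroup : ∀ q j → 0ℤ ℤ.+ q ℤ.* + 2 ℤ.+ (1ℤ ℤ.+ j ℤ.* + 2) ≡ 1ℤ ℤ.+ (q ℤ.+ j) ℤ.* + 2
  regroup = ZS.solve-∀
  odd : (z ℤ.+ + suc (2 * j)) ℤ.%ℕ 2 ≡ 1
  odd = %ℕ-unique (z ℤ./ℕ 2 ℤ.+ + j) (s≤s (s≤s z≤n))
          (trans (cong₂ ℤ._+_ z≡ odd-offset) (regroup (z ℤ./ℕ 2) (+ j)))

odd-+-1 : ∀ {z} → z ℤ.%ℕ 2 ≢ 0 → (z ℤ.+ 1ℤ) ℤ.%ℕ 2 ≡ 0
odd-+-1 {z} z≢0 = %ℕ-unique (z ℤ./ℕ 2 ℤ.+ 1ℤ) (s≤s z≤n) (trans (cong (λ y → y ℤ.+ 1ℤ) z≡) (regroup (z ℤ./ℕ 2)))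
  where
  one : ∀ {r} → r < 2 → r ≢ 0 → r ≡ 1
  one (s≤s z≤n)       r≢0 = ⊥-elim (r≢0 refl)
  one (s≤s (s≤s z≤n)) _   = refl
  z≡ : z ≡ 1ℤ ℤ.+ z ℤ./ℕ 2 ℤ.* + 2
  z≡ = subst (λ r → z ≡ + r ℤ.+ z ℤ./ℕ 2 ℤ.* + 2) (one (n%ℕd<d z 2) z≢0) (a≡a%ℕn+[a/ℕn]*n z 2)
  regroup : ∀ q → 1ℤ ℤ.+ q ℤ.* + 2 ℤ.+ 1ℤ ≡ 0ℤ ℤ.+ (q ℤ.+ 1ℤ) ℤ.* + 2
  regroup = ZS.solve-∀

/-cross-≤ : ∀ a b c d → a * suc d ≤ c * suc b → + a / suc b ℚ.≤ + c / suc d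
/-cross-≤ a b c d h = ℚP.toℚᵘ-cancel-≤
  (ℚᵘP.≤-respˡ-≃ (ℚᵘP.≃-sym (ℚP.toℚᵘ-fromℚᵘ (mkℚᵘ (+ a) b)))
    (ℚᵘP.≤-respʳ-≃ (ℚᵘP.≃-sym (ℚP.toℚᵘ-fromℚᵘ (mkℚᵘ (+ c) d)))
      (ℚᵘ.*≤* (subst₂ ℤ._≤_ (ℤP.pos-* a (suc d)) (ℤP.pos-* c (suc b)) (ℤ.+≤+ h)))))

/-cross-< : ∀ a b c d → a * suc d < c * suc b → + a / suc b ℚ.< + c / suc d
/-cross-< a b c d h = ℚP.toℚᵘ-cancel-<
  (ℚᵘP.<-respˡ-≃ (ℚᵘP.≃-sym (ℚP.toℚᵘ-fromℚᵘ (mkℚᵘ (+ a) b)))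
    (ℚᵘP.<-respʳ-≃ (ℚᵘP.≃-sym (ℚP.toℚᵘ-fromℚᵘ (mkℚᵘ (+ c) d)))
      (ℚᵘ.*<* (subst₂ ℤ._<_ (ℤP.pos-* a (suc d)) (ℤP.pos-* c (suc b)) (ℤ.+<+ h)))))

/-+-/ : ∀ a b c d → + a / suc b ℚ.+ + c / suc d ≡ + (a * suc d + c * suc b) / (suc b * suc d)
/-+-/ a b c d = ℚP.toℚᵘ-injective (begin
  ℚ.toℚᵘ (+ a / suc b ℚ.+ + c / suc d)
    ≈⟨ ℚP.toℚᵘ-homo-+ (+ a / suc b) (+ c / suc d) ⟩
  ℚ.toℚᵘ (+ a / suc b) ℚᵘ.+ ℚ.toℚᵘ (+ c / suc d)
    ≈⟨ ℚᵘP.+-cong (ℚP.toℚᵘ-fromℚᵘ (mkℚᵘ (+ a) b)) (ℚP.toℚᵘ-fromℚᵘ (mkℚᵘ (+ c) d)) ⟩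
  mkℚᵘ (+ a) b ℚᵘ.+ mkℚᵘ (+ c) d
    ≡⟨ cong (λ n → mkℚᵘ n (d + b * suc d)) numerator ⟩
  mkℚᵘ (+ (a * suc d + c * suc b)) (d + b * suc d)
    ≈⟨ ℚP.toℚᵘ-fromℚᵘ (mkℚᵘ (+ (a * suc d + c * suc b)) (d + b * suc d)) ⟨
  ℚ.toℚᵘ (+ (a * suc d + c * suc b) / (suc b * suc d)) ∎)
  where
  open ℚᵘP.≃-Reasoning
  numerator : + a ℤ.* + suc d ℤ.+ + c ℤ.* + suc b ≡ + (a * suc d + c * suc b)
  numerator = trans (cong₂ ℤ._+_ (sym (ℤP.pos-* a (suc d))) (sym (ℤP.pos-* c (suc b))))
                    (sym (ℤP.pos-+ (a * suc d) (c * suc b)))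

positive⇒1/suc≤ : ∀ {ε} → 0ℚ ℚ.< ε → Σ ℕ λ e → + 1 / suc e ℚ.≤ ε
positive⇒1/suc≤ {ε@(mkℚ +[1+ p ] e _)} _ =
  e , subst (+ 1 / suc e ℚ.≤_) (ℚP.fromℚᵘ-toℚᵘ ε) (/-cross-≤ 1 e (suc p) e (*-monoˡ-≤ (suc e) (s≤s (z≤n {p}))))
positive⇒1/suc≤ {mkℚ (+ zero) _ _} (ℚ.*<* (ℤ.+<+ ()))
positive⇒1/suc≤ {mkℚ -[1+ _ ] _ _} (ℚ.*<* ())

p<q+r⇒p-r<q : ∀ {p q r} → p ℚ.< q ℚ.+ r → p ℚ.- r ℚ.< q
p<q+r⇒p-r<q {p} {q} {r} p<q+r = subst (p ℚ.- r ℚ.<_) cancel (ℚP.+-monoˡ-< (ℚ.- r) p<q+r)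
  where
  cancel : q ℚ.+ r ℚ.- r ≡ q
  cancel = trans (ℚP.+-assoc q r (ℚ.- r)) (trans (cong (ℚ._+_ q) (ℚP.+-inverseʳ r)) (ℚP.+-identityʳ q))

distance-cases : ∀ x y → y ≡ x ℤ.+ + ∣ x ℤ.- y ∣ ⊎ x ≡ y ℤ.+ + ∣ x ℤ.- y ∣
distance-cases x y with ℤP.+∣i∣≡i⊎+∣i∣≡-i (x ℤ.- y)
... | inj₁ ∣x-y∣≡x-y  = inj₂ (trans (sym (y+[x-y] x y)) (cong (ℤ._+_ y) (sym ∣x-y∣≡x-y)))
  where
  y+[x-y] : ∀ x y → y ℤ.+ (x ℤ.- y) ≡ x
  y+[x-y] = ZS.solve-∀
... | inj₂ ∣x-y∣≡y-x = inj₁ (trans (sym (x-[x-y] x y)) (cong (ℤ._+_ x) (sym ∣x-y∣≡y-x)))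
  where
  x-[x-y] : ∀ x y → x ℤ.+ ℤ.- (x ℤ.- y) ≡ y
  x-[x-y] = ZS.solve-∀

independent-by-translation : ∀ {S A} → (∀ {d} → d ∈ S → ∀ x → A x ≡ true → A (x ℤ.+ + d) ≡ true → ⊥) →
                             Independent S A
independent-by-translation {A = A} avoids x y x∈ y∈ d∈S with distance-cases x y
... | inj₁ y≡ = avoids d∈S x x∈ (subst (λ z → A z ≡ true) y≡ y∈)
... | inj₂ x≡ = avoids d∈S y y∈ (subst (λ z → A z ≡ true) x≡ x∈)

module Stripes (H L : ℕ) .{{_ : ℕ.NonZero H}} where

  Cell : ℕ → ℤ → Set
  Cell r q = r < L × (+ r ℤ.+ q) ℤ.%ℕ 2 ≡ 0

  cell? : ∀ r q → Dec (Cell r q)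
  cell? r q = r <? L ×-dec (+ r ℤ.+ q) ℤ.%ℕ 2 ℕ.≟ 0

  stripes : Subsetℤ
  stripes x = ⌊ cell? (x ℤ.%ℕ H) (x ℤ./ℕ H) ⌋

  stripes-≡ : ∀ {x r} q → r < H → x ≡ + r ℤ.+ q ℤ.* + H → stripes x ≡ ⌊ cell? r q ⌋
  stripes-≡ q r<H x≡ = cong₂ (λ r q → ⌊ cell? r q ⌋) (proj₁ unique) (proj₂ unique)
    where unique = %ℕ-/ℕ-unique q r<H x≡

  ∈-stripes : ∀ {x r} q → r < H → x ≡ + r ℤ.+ q ℤ.* + H → stripes x ≡ true → Cell r q
  ∈-stripes {r = r} q r<H x≡ x∈ =
    toWitness {a? = cell? r q} (Equivalence.from T-≡ (trans (sym (stripes-≡ q r<H x≡)) x∈))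

  private
    decompose : ∀ x → x ≡ + (x ℤ.%ℕ H) ℤ.+ x ℤ./ℕ H ℤ.* + H
    decompose x = a≡a%ℕn+[a/ℕn]*n x H

  stripes-avoids-odd : ∀ j → L + suc (2 * j) ≤ H →
                       ∀ x → stripes x ≡ true → stripes (x ℤ.+ + suc (2 * j)) ≡ true → ⊥
  stripes-avoids-odd j L+d≤H x x∈ y∈ = even-+-odd {+ s ℤ.+ q} even j (subst (λ z → z ℤ.%ℕ 2 ≡ 0) parity even′)
    where
    d = suc (2 * j)
    s = x ℤ.%ℕ H
    q = x ℤ./ℕ H
    s<H : s < H
    s<H = n%ℕd<d x H
    cell : Cell s q
    cell = ∈-stripes q s<H (decompose x) x∈
    even : (+ s ℤ.+ q) ℤ.%ℕ 2 ≡ 0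
    even = proj₂ cell
    s+d<H : s + d < H
    s+d<H = <-≤-trans (+-monoˡ-< d (proj₁ cell)) L+d≤H
    regroup : ∀ s q h d → s ℤ.+ q ℤ.* h ℤ.+ d ≡ s ℤ.+ d ℤ.+ q ℤ.* h
    regroup = ZS.solve-∀
    y≡ : x ℤ.+ + d ≡ + (s + d) ℤ.+ q ℤ.* + H
    y≡ = trans (cong (λ z → z ℤ.+ + d) (decompose x))
               (trans (regroup (+ s) q (+ H) (+ d)) (cong (λ z → z ℤ.+ q ℤ.* + H) (sym (ℤP.pos-+ s d))))
    even′ : (+ (s + d) ℤ.+ q) ℤ.%ℕ 2 ≡ 0
    even′ = proj₂ (∈-stripes q s+d<H y≡ y∈)
    swap : ∀ s d q → s ℤ.+ d ℤ.+ q ≡ s ℤ.+ q ℤ.+ d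
    swap = ZS.solve-∀
    parity : + (s + d) ℤ.+ q ≡ + s ℤ.+ q ℤ.+ + d
    parity = trans (cong (ℤ._+ q) (ℤP.pos-+ s d)) (swap (+ s) (+ d) q)

  stripes-avoids-width : ∀ x → stripes x ≡ true → stripes (x ℤ.+ + H) ≡ true → ⊥
  stripes-avoids-width x x∈ y∈ =
    even-+-odd {+ s ℤ.+ q} even 0 (subst (λ z → z ℤ.%ℕ 2 ≡ 0) (sym (ℤP.+-assoc (+ s) q 1ℤ)) even′)
    where
    s = x ℤ.%ℕ H
    q = x ℤ./ℕ H
    s<H : s < H
    s<H = n%ℕd<d x H
    even : (+ s ℤ.+ q) ℤ.%ℕ 2 ≡ 0
    even = proj₂ (∈-stripes q s<H (decompose x) x∈)
    regroup : ∀ s q h → s ℤ.+ q ℤ.* h ℤ.+ h ≡ s ℤ.+ (q ℤ.+ 1ℤ) ℤ.* h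
    regroup = ZS.solve-∀
    y≡ : x ℤ.+ + H ≡ + s ℤ.+ (q ℤ.+ 1ℤ) ℤ.* + H
    y≡ = trans (cong (ℤ._+ + H) (decompose x)) (regroup (+ s) q (+ H))
    even′ : (+ s ℤ.+ (q ℤ.+ 1ℤ)) ℤ.%ℕ 2 ≡ 0
    even′ = proj₂ (∈-stripes (q ℤ.+ 1ℤ) s<H y≡ y∈)

  stripes-periodic : ∀ x → stripes (x ℤ.+ + (H + H)) ≡ stripes x
  stripes-periodic x = trans (stripes-≡ (q ℤ.+ + 2) (n%ℕd<d x H) x+2H≡)
                             (cong (λ p → ⌊ s <? L ×-dec p ℕ.≟ 0 ⌋) parity)
    where
    s = x ℤ.%ℕ H
    q = x ℤ./ℕ H
    regroup : ∀ s q h → s ℤ.+ q ℤ.* h ℤ.+ (h ℤ.+ h) ≡ s ℤ.+ (q ℤ.+ + 2) ℤ.* h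
    regroup = ZS.solve-∀
    x+2H≡ : x ℤ.+ + (H + H) ≡ + s ℤ.+ (q ℤ.+ + 2) ℤ.* + H
    x+2H≡ = trans (cong₂ ℤ._+_ (decompose x) (ℤP.pos-+ H H)) (regroup (+ s) q (+ H))
    shift : ∀ s q → s ℤ.+ q ℤ.+ 1ℤ ℤ.* + 2 ≡ s ℤ.+ (q ℤ.+ + 2)
    shift = ZS.solve-∀
    parity : (+ s ℤ.+ (q ℤ.+ + 2)) ℤ.%ℕ 2 ≡ (+ s ℤ.+ q) ℤ.%ℕ 2
    parity = trans (cong (ℤ._%ℕ 2) (sym (shift (+ s) q))) ([x+m*d]%ℕd≡x%ℕd (+ s ℤ.+ q) 1ℤ)

  private
    r+0+1 : ∀ {r} → + r ℤ.+ 0ℤ ℤ.+ 1ℤ ≡ + r ℤ.+ 1ℤ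
    r+0+1 {r} = cong (ℤ._+ 1ℤ) (ℤP.+-identityʳ (+ r))

  cell-complement : ∀ {r} → r < L → ⌊ cell? r 1ℤ ⌋ ≡ not ⌊ cell? r 0ℤ ⌋
  cell-complement {r} r<L with cell? r 0ℤ | cell? r 1ℤ
  ... | yes (_ , even₀) | yes (_ , even₁) =
    ⊥-elim (even-+-odd {+ r ℤ.+ 0ℤ} even₀ 0 (subst (λ z → z ℤ.%ℕ 2 ≡ 0) (sym (r+0+1 {r})) even₁))
  ... | yes _           | no _            = refl
  ... | no _            | yes _           = refl
  ... | no ¬cell₀       | no ¬cell₁       =
    ⊥-elim (¬cell₁ (r<L , subst (λ z → z ℤ.%ℕ 2 ≡ 0) (r+0+1 {r}) (odd-+-1 {+ r ℤ.+ 0ℤ} λ even₀ → ¬cell₀ (r<L , even₀))))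

  stripes-blocks-complementary : ∀ {j} → j < L → L ≤ H → stripes (+ H ℤ.+ + j) ≡ not (stripes (0ℤ ℤ.+ + j))
  stripes-blocks-complementary {j} j<L L≤H = begin
    stripes (+ H ℤ.+ + j)      ≡⟨ stripes-≡ 1ℤ j<H (block₁ (+ H) (+ j)) ⟩
    ⌊ cell? j 1ℤ ⌋             ≡⟨ cell-complement j<L ⟩
    not ⌊ cell? j 0ℤ ⌋         ≡⟨ cong not (stripes-≡ 0ℤ j<H (block₀ (+ H) (+ j))) ⟨
    not (stripes (0ℤ ℤ.+ + j)) ∎
    where
    open ≡-Reasoning
    j<H : j < H
    j<H = <-≤-trans j<L L≤H
    block₀ : ∀ a b → 0ℤ ℤ.+ b ≡ b ℤ.+ 0ℤ ℤ.* a
    block₀ = ZS.solve-∀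
    block₁ : ∀ a b → a ℤ.+ b ≡ b ℤ.+ 1ℤ ℤ.* a
    block₁ = ZS.solve-∀

  stripes-period-count : L ≤ H → L ≤ countFrom stripes 0ℤ (H + H)
  stripes-period-count L≤H = begin
    L                                                    ≡⟨ countFrom-complement L blocks ⟨
    countFrom stripes 0ℤ L + countFrom stripes (+ H) L   ≤⟨ +-mono-≤ (countFrom-mono stripes 0ℤ L≤H)
                                                                     (countFrom-mono stripes (+ H) L≤H) ⟩
    countFrom stripes 0ℤ H + countFrom stripes (+ H) H   ≡⟨ countFrom-+ stripes 0ℤ H H ⟨
    countFrom stripes 0ℤ (H + H)                         ∎
    where
    open ≤-Reasoning
    blocks : ∀ j → j < L → stripes (+ H ℤ.+ + j) ≡ not (stripes (0ℤ ℤ.+ + j))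
    blocks _ j<L = stripes-blocks-complementary j<L L≤H

  stripes-density : L ≤ H → ∀ t → + L / suc (H + H) ℚ.≤ ratio stripes (suc t * (H + H))
  stripes-density L≤H t = /-cross-≤ L M (count stripes (suc t * M)) (2 * (suc t * M)) (begin
    L * suc (2 * (suc t * M))                     ≤⟨ m≤m+n _ (L + 2 * t * L) ⟩
    L * suc (2 * (suc t * M)) + (L + 2 * t * L)   ≡⟨ regroup L t M ⟩
    (2 * suc t) * L * suc M                       ≤⟨ *-monoˡ-≤ (suc M) (*-monoʳ-≤ (2 * suc t) (stripes-period-count L≤H)) ⟩
    (2 * suc t) * countFrom stripes 0ℤ M * suc M  ≤⟨ *-monoˡ-≤ (suc M) (count-periods (suc t)) ⟩
    count stripes (suc t * M) * suc M             ∎)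
    where
    open ≤-Reasoning
    open Periodic stripes (H + H) stripes-periodic using (count-periods)
    M = H + H
    regroup : ∀ L t M → L * suc (2 * (suc t * M)) + (L + 2 * t * L) ≡ (2 * suc t) * L * suc M
    regroup = solve-∀

ratio≤½+1/suc : ∀ c N e → 2 * c ≤ suc (suc (2 * N)) → e ≤ N → + c / suc (2 * N) ℚ.≤ ½ ℚ.+ + 1 / suc e
ratio≤½+1/suc c N e 2c≤ e≤N =
  subst (+ c / suc (2 * N) ℚ.≤_) (sym (/-+-/ 1 1 1 e)) (/-cross-≤ c (2 * N) (1 * suc e + 1 * 2) (e + 1 * suc e) (begin
    c * (2 * suc e)                         ≡⟨ solve₁ c e ⟩
    2 * c * suc e                           ≤⟨ *-monoˡ-≤ (suc e) 2c≤ ⟩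
    suc (suc (2 * N)) * suc e               ≡⟨ solve₂ N e ⟩
    suc e * suc (2 * N) + suc e             ≤⟨ +-monoʳ-≤ (suc e * suc (2 * N)) suc-e≤ ⟩
    suc e * suc (2 * N) + 2 * suc (2 * N)   ≡⟨ solve₃ N e ⟩
    (1 * suc e + 1 * 2) * suc (2 * N)       ∎))
  where
  open ≤-Reasoning
  solve₁ : ∀ c e → c * (2 * suc e) ≡ 2 * c * suc e
  solve₁ = solve-∀
  solve₂ : ∀ N e → suc (suc (2 * N)) * suc e ≡ suc e * suc (2 * N) + suc e
  solve₂ = solve-∀
  solve₃ : ∀ N e → suc e * suc (2 * N) + 2 * suc (2 * N) ≡ (1 * suc e + 1 * 2) * suc (2 * N)
  solve₃ = solve-∀
  suc-e≤ : suc e ≤ 2 * suc (2 * N)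
  suc-e≤ = ≤-trans (s≤s (≤-trans e≤N (m≤m+n N (N + 0)))) (m≤m+n (suc (2 * N)) _)

independent⇒density≤½ : ∀ {S A} → 1 ∈ S → Independent S A → DensityLe A ½
independent⇒density≤½ {S} {A} 1∈S independent δ δ>0 with positive⇒1/suc≤ δ>0
... | e , 1/suc-e≤δ = e , λ N e≤N →
  ℚP.≤-trans (ratio≤½+1/suc (count A N) N e (countFrom-no-consecutive A apart _ _) e≤N) (ℚP.+-monoʳ-≤ ½ 1/suc-e≤δ)
  where
  [x+1]-x : ∀ x → x ℤ.+ 1ℤ ℤ.- x ≡ 1ℤ
  [x+1]-x = ZS.solve-∀
  apart : ∀ x → A x ≡ true → A (x ℤ.+ 1ℤ) ≡ true → ⊥
  apart x x∈ x+1∈ = independent (x ℤ.+ 1ℤ) x x+1∈ x∈ (subst (_∈ S) (sym (cong ∣_∣ ([x+1]-x x))) 1∈S)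

AlphaLt-½+ : ∀ {S ε} → 1 ∈ S → 0ℚ ℚ.< ε → AlphaLt S (½ ℚ.+ ε)
AlphaLt-½+ {ε = ε} 1∈S ε>0 =
  ½ , subst (ℚ._< ½ ℚ.+ ε) (ℚP.+-identityʳ ½) (ℚP.+-monoʳ-< ½ ε>0) , λ _ → independent⇒density≤½ 1∈S

½<stripes-ratio+1/suc : ∀ L D H e → L + D ≡ H → suc (2 * D) * suc e ≤ H + H →
                        ½ ℚ.< + L / suc (H + H) ℚ.+ + 1 / suc e
½<stripes-ratio+1/suc L D _ e refl small =
  subst (½ ℚ.<_) (sym (/-+-/ L M 1 e)) (/-cross-< 1 1 (L * suc e + 1 * suc M) (e + M * suc e) (begin-strict
    1 * suc (e + M * suc e)                 ≡⟨ solve₁ L D e ⟩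
    2 * L * suc e + suc (2 * D) * suc e     ≤⟨ +-monoʳ-≤ (2 * L * suc e) small ⟩
    2 * L * suc e + M                       <⟨ m<m+n _ {suc (suc M)} (s≤s z≤n) ⟩
    2 * L * suc e + M + suc (suc M)         ≡⟨ solve₂ L D e ⟩
    (L * suc e + 1 * suc M) * 2             ∎))
  where
  open ≤-Reasoning
  M = (L + D) + (L + D)
  solve₁ : ∀ L D e → 1 * suc (e + ((L + D) + (L + D)) * suc e) ≡ 2 * L * suc e + suc (2 * D) * suc e
  solve₁ = solve-∀
  solve₂ : ∀ L D e → 2 * L * suc e + ((L + D) + (L + D)) + suc (suc ((L + D) + (L + D)))
                   ≡ (L * suc e + 1 * suc ((L + D) + (L + D))) * 2
  solve₂ = solve-∀

S3-independent : ∀ i k L .{{_ : ℕ.NonZero (2 * k)}} → L + suc (2 * i) ≡ 2 * k →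
                 Independent (S3 i k) (Stripes.stripes (2 * k) L)
S3-independent i k L L+D≡H = independent-by-translation avoids
  where
  open Stripes (2 * k) L
  avoids : ∀ {d} → d ∈ S3 i k → ∀ x → stripes x ≡ true → stripes (x ℤ.+ + d) ≡ true → ⊥
  avoids (here refl)                 = stripes-avoids-odd 0 (≤-trans (+-monoʳ-≤ L (s≤s z≤n)) (≤-reflexive L+D≡H))
  avoids (there (here refl))         = stripes-avoids-odd i (≤-reflexive L+D≡H)
  avoids (there (there (here refl))) = stripes-avoids-width

AlphaGt-S3 : ∀ i k e {ε} → + 1 / suc e ℚ.≤ ε → suc (2 * suc (2 * i)) * suc e ≤ k → AlphaGt (S3 i k) (½ ℚ.- ε)
AlphaGt-S3 i (suc k) e {ε} 1/suc-e≤ε K≤k =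
  stripes , S3-independent i (suc k) L L+D≡H , + L / suc (H + H) , ½-ε<ratio ,
  λ N₀ → suc N₀ * (H + H) , ≤-trans (n≤1+n N₀) (m≤m*n (suc N₀) (H + H)) , stripes-density L≤H N₀
  where
  D = suc (2 * i)
  H = 2 * suc k
  L = H ∸ D
  K≤H : suc (2 * D) * suc e ≤ H
  K≤H = ≤-trans K≤k (m≤n*m (suc k) 2)
  L+D≡H : L + D ≡ H
  L+D≡H = m∸n+n≡m (≤-trans D≤K K≤H)
    where
    D≤K : D ≤ suc (2 * D) * suc e
    D≤K = ≤-trans (≤-trans (m≤m+n D (D + 0)) (n≤1+n _)) (m≤m*n (suc (2 * D)) (suc e))
  L≤H : L ≤ H
  L≤H = m∸n≤m H D
  open Stripes H L
  ½-ε<ratio : ½ ℚ.- ε ℚ.< + L / suc (H + H)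
  ½-ε<ratio = p<q+r⇒p-r<q (ℚP.<-≤-trans
    (½<stripes-ratio+1/suc L D H e L+D≡H (≤-trans K≤H (m≤m+n H H)))
    (ℚP.+-monoʳ-≤ (+ L / suc (H + H)) 1/suc-e≤ε))

theorem23 : (i : ℕ) → 1 ≤ i → (ε : ℚ) → 0ℚ ℚ.< ε →
    Σ ℕ λ K → (k : ℕ) → K ≤ k →
      AlphaGt (S3 i k) (½ ℚ.- ε) × AlphaLt (S3 i k) (½ ℚ.+ ε)
theorem23 i _ ε ε>0 with positive⇒1/suc≤ ε>0
... | e , 1/suc-e≤ε =
  suc (2 * suc (2 * i)) * suc e , λ k K≤k → AlphaGt-S3 i k e 1/suc-e≤ε K≤k , AlphaLt-½+ (here refl) ε>0
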